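{- For every class of structures, the function mapping a triple $(\mathfrak A,X,Y)$ (with $\mathfrak A$ in the class and $X,Y$ subsets of its universe) to the cut-rank of $X\cup Y$ in $\mathfrak A$ is asymptotically bounded by the function mapping $(\mathfrak A,X,Y)$ to the maximum of the cut-rank of $X$ and the cut-rank of $Y$ in $\mathfrak A$.
   Context: Structures are finite over a finite vocabulary of relation names (arities $\ge 1$); a class of structures uses one vocabulary and is closed under isomorphism. For a structure with maximal arity $m$ and a subset $X$ of its universe, the type matrix of $X$ has rows indexed by $\bar x\in X^m$, columns by tuples $\bar y$ in (complement of $X$)$^m$, and entries the quantifier-free type of $\bar x\bar y$; the cut-rank of $X$ is the number of distinct rows. A function $\mu_1:D\to\mathbb N$ is (asymptotically) bounded by $\mu_2:D\to\mathbb N$ if for every $Z\subseteq D$, if $\mu_2$ is bounded on $Z$ then $\mu_1$ is bounded on $Z$. -}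

module Defs where

open import Data.Nat using (ℕ; zero; suc; _+_; _≤_; _⊔_)
open import Data.Bool using (Bool; true; false; _∧_; not)
open import Data.Fin using (Fin; _≟_)
open import Data.Fin.Subset using (Subset; _∪_; ∁)
open import Data.Vec using (Vec; []; _∷_; lookup; map; _++_)
open import Data.List using (List; []; _∷_; concatMap; filter; length; allFin; foldr)
import Data.List as L
open import Data.Product using (Σ; ∃; _,_)
open import Relation.Nullary.Decidable using (does)
open import Relation.Binary.PropositionalEquality using (_≡_)
open import Function.Bundles using (_⤖_; Bijection)

record Vocabulary : Set where
  field
    k    : ℕ
    ar   : Fin k → ℕ
    ar≥1 : (R : Fin k) → 1 ≤ ar R
open Vocabulary public

maxArity : Vocabulary → ℕ
maxArity τ = foldr (λ R acc → ar τ R ⊔ acc) 0 (allFin (k τ))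

-- A finite structure; the universe is Fin size (every finite set is in
-- bijection with some Fin n, and classes are closed under isomorphism).
record Structure (τ : Vocabulary) : Set where
  field
    size : ℕ
    rel  : (R : Fin (k τ)) → Vec (Fin size) (ar τ R) → Bool
open Structure public

record Iso {τ : Vocabulary} (𝔄 𝔅 : Structure τ) : Set where
  field
    bij      : Fin (size 𝔄) ⤖ Fin (size 𝔅)
    preserve : (R : Fin (k τ)) (t : Vec (Fin (size 𝔄)) (ar τ R)) →
               rel 𝔅 R (map (Bijection.to bij) t) ≡ rel 𝔄 R t

IsoClosed : {τ : Vocabulary} → (Structure τ → Set) → Set
IsoClosed {τ} C = (𝔄 𝔅 : Structure τ) → Iso 𝔄 𝔅 → C 𝔄 → C 𝔅

_==_ : Bool → Bool → Bool
true  == b = b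
false == b = not b

all : {A : Set} → (A → Bool) → List A → Bool
all p [] = true
all p (x ∷ xs) = p x ∧ all p xs

allTuples : (n l : ℕ) → List (Vec (Fin n) l)
allTuples n zero = [] ∷ []
allTuples n (suc l) = concatMap (λ i → L.map (i ∷_) (allTuples n l)) (allFin n)

inSubset : {n l : ℕ} → Subset n → Vec (Fin n) l → Bool
inSubset X [] = true
inSubset X (x ∷ xs) = lookup X x ∧ inSubset X xs

tuplesIn : {n : ℕ} (l : ℕ) → Subset n → List (Vec (Fin n) l)
tuplesIn {n} l X = L.filterᵇ (inSubset X) (allTuples n l)

-- Equality of quantifier-free types of two l-tuples of 𝔄:
-- they satisfy the same atomic formulas  v_i = v_j  and  R(v_{σ 1},...,v_{σ r}).
sameQfType : {τ : Vocabulary} (𝔄 : Structure τ) {l : ℕ} →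
             Vec (Fin (size 𝔄)) l → Vec (Fin (size 𝔄)) l → Bool
sameQfType {τ} 𝔄 {l} z z' =
  all (λ i → all (λ j → does (lookup z i ≟ lookup z j) == does (lookup z' i ≟ lookup z' j))
                 (allFin l)) (allFin l)
  ∧ all (λ R → all (λ σ → rel 𝔄 R (map (lookup z) σ) == rel 𝔄 R (map (lookup z') σ))
                   (allTuples l (ar τ R))) (allFin (k τ))

-- Two rows of the type matrix of X (rows x̄, x̄' ∈ X^m) are equal iff for
-- every column ȳ ∈ (complement of X)^m, tp(x̄ȳ) = tp(x̄'ȳ).
sameRow : {τ : Vocabulary} (𝔄 : Structure τ) (X : Subset (size 𝔄)) →
          Vec (Fin (size 𝔄)) (maxArity τ) → Vec (Fin (size 𝔄)) (maxArity τ) → Bool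
sameRow {τ} 𝔄 X x x' =
  all (λ y → sameQfType 𝔄 (x ++ y) (x' ++ y)) (tuplesIn (maxArity τ) (∁ X))

cutRank : {τ : Vocabulary} (𝔄 : Structure τ) → Subset (size 𝔄) → ℕ
cutRank {τ} 𝔄 X = length (L.deduplicateᵇ (sameRow 𝔄 X) (tuplesIn (maxArity τ) X))

BoundedOn : {D : Set} → (D → ℕ) → (D → Set) → Set
BoundedOn {D} μ Z = ∃ λ b → (d : D) → Z d → μ d ≤ b

AsympBounded : {D : Set} → (D → ℕ) → (D → ℕ) → Set₁
AsympBounded {D} μ₁ μ₂ = (Z : D → Set) → BoundedOn μ₂ Z → BoundedOn μ₁ Z

record Triple {τ : Vocabulary} (C : Structure τ → Set) : Set where
  constructor triple
  field
    𝔄   : Structure τ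
    in𝒞 : C 𝔄
    X   : Subset (size 𝔄)
    Y   : Subset (size 𝔄)
open Triple public

cutRankUnion : {τ : Vocabulary} {C : Structure τ → Set} → Triple C → ℕ
cutRankUnion t = cutRank (𝔄 t) (X t ∪ Y t)

cutRankMax : {τ : Vocabulary} {C : Structure τ → Set} → Triple C → ℕ
cutRankMax t = cutRank (𝔄 t) (X t) ⊔ cutRank (𝔄 t) (Y t)

-- Let U = X ∪ Y and m the maximal arity. Take x̄ ∈ U^m and let x̄′ arise from x̄ by replacing its entries
-- in X by the corresponding entries of some w̄′ ∈ X^m lying in the same row of the type matrix of X as the
-- X-part of x̄. Then x̄ and x̄′ lie in the same row of the type matrix of U: every column of U is a column
-- of X, and an atomic formula has at most m arguments, so its arguments outside X fit into one column of X.
-- Replacing first the X-entries by a fixed row representative of X, then the Y-entries by one of Y, turns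
-- x̄ into a tuple determined by the positions of x̄ in X and by the two representatives. Hence
-- cr(X ∪ Y) ≤ 2^m (1 + cr X) (1 + cr Y), which is bounded wherever max(cr X, cr Y) is.
module Submission where

open import Defs

open import Data.Bool using (Bool; true; false; _∧_; _∨_; not; T; if_then_else_)
open import Data.Bool.Properties
  using (T?; T-∧; T-≡; not-injective; not-¬; ∨-zeroʳ) renaming (_≟_ to _≟ᴮ_)
open import Data.Empty using (⊥-elim)
open import Data.Fin as Fin using (Fin; _≟_; _↑ˡ_; _↑ʳ_; splitAt; inject≤)
import Data.Fin.Properties as Finₚ
open import Data.Fin.Subset using (Subset; _∪_; ∁)
open import Data.List as List using (List; []; _∷_; length; allFin; cartesianProduct; deduplicate)
import Data.List.Properties as Listₚ
open import Data.List.Membership.Propositional using (_∈_; _─_; lose; find)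
import Data.List.Membership.Propositional.Properties as ∈ₚ
open import Data.List.Relation.Unary.All as All using (All; []; _∷_)
open import Data.List.Relation.Unary.AllPairs as AllPairs using (AllPairs; []; _∷_)
import Data.List.Relation.Unary.AllPairs.Properties as AllPairsₚ
open import Data.List.Relation.Unary.Any using (here; there)
import Data.List.Relation.Unary.Any.Properties as Anyₚ
open import Data.Maybe using (Maybe; just; nothing)
open import Data.Nat using (ℕ; zero; suc; _+_; _*_; _^_; _≤_; _⊔_; z≤n; s≤s)
import Data.Nat.Properties as ℕₚ
open import Data.Product using (∃; _×_; _,_; proj₁; proj₂)
open import Data.Sum using (_⊎_; inj₁; inj₂)
open import Data.Unit using (tt)
open import Data.Vec as Vec using (Vec; []; _∷_; lookup; _++_; tabulate)
import Data.Vec.Properties as Vecₚ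
open import Function using (_∘_)
open import Function.Bundles using (Equivalence; _⇔_; mk⇔)
open import Level using (0ℓ)
open import Relation.Binary.Core using (Rel)
open import Relation.Binary.Definitions using (Decidable)
open import Relation.Binary.PropositionalEquality
open import Relation.Nullary using (¬_; Dec; yes; no; does; ¬?)

==⇒≡ : ∀ a b → T (a == b) → a ≡ b
==⇒≡ true  true  _ = refl
==⇒≡ false false _ = refl

≡⇒== : ∀ {a b} → a ≡ b → T (a == b)
≡⇒== {true}  refl = tt
≡⇒== {false} refl = tt

all-sound : ∀ {A : Set} (p : A → Bool) {xs x} → T (all p xs) → x ∈ xs → T (p x)
all-sound p {y ∷ _} t (here refl) = proj₁ (Equivalence.to T-∧ t)
all-sound p {y ∷ _} t (there x∈xs) = all-sound p (proj₂ (Equivalence.to (T-∧ {p y}) t)) x∈xs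

all-complete : ∀ {A : Set} (p : A → Bool) xs → (∀ {x} → x ∈ xs → T (p x)) → T (all p xs)
all-complete p []       _ = tt
all-complete p (y ∷ xs) h = Equivalence.from T-∧ (h (here refl) , all-complete p xs (h ∘ there))

∈-allTuples : ∀ {n l} (v : Vec (Fin n) l) → v ∈ allTuples n l
∈-allTuples []      = here refl
∈-allTuples (i ∷ v) = ∈ₚ.∈-concatMap⁺ _ (lose (∈ₚ.∈-allFin i) (∈ₚ.∈-map⁺ (i ∷_) (∈-allTuples v)))

Inside Outside : ∀ {n l} → Subset n → Vec (Fin n) l → Set
Inside  X v = ∀ i → lookup X (lookup v i) ≡ true
Outside X v = ∀ i → lookup X (lookup v i) ≡ false

inSubset-sound : ∀ {n l} (X : Subset n) (v : Vec (Fin n) l) → T (inSubset X v) → Inside X v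
inSubset-sound X (a ∷ v) t Fin.zero    = Equivalence.to T-≡ (proj₁ (Equivalence.to T-∧ t))
inSubset-sound X (a ∷ v) t (Fin.suc i) =
  inSubset-sound X v (proj₂ (Equivalence.to (T-∧ {lookup X a}) t)) i

inSubset-complete : ∀ {n l} (X : Subset n) (v : Vec (Fin n) l) → Inside X v → T (inSubset X v)
inSubset-complete X []      _ = tt
inSubset-complete X (a ∷ v) h =
  Equivalence.from T-∧ (Equivalence.from T-≡ (h Fin.zero) , inSubset-complete X v (h ∘ Fin.suc))

∈-tuplesIn⁺ : ∀ {n l} {X : Subset n} {v : Vec (Fin n) l} → Inside X v → v ∈ tuplesIn l X
∈-tuplesIn⁺ {X = X} {v} h = ∈ₚ.∈-filter⁺ (T? ∘ inSubset X) (∈-allTuples v) (inSubset-complete X v h)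

∈-tuplesIn⁻ : ∀ {n l} {X : Subset n} {v : Vec (Fin n) l} → v ∈ tuplesIn l X → Inside X v
∈-tuplesIn⁻ {n} {l} {X} {v} v∈ =
  inSubset-sound X v (proj₂ (∈ₚ.∈-filter⁻ (T? ∘ inSubset X) {xs = allTuples n l} v∈))

Inside-∁⇔Outside : ∀ {n l} (X : Subset n) (v : Vec (Fin n) l) → Inside (∁ X) v ⇔ Outside X v
Inside-∁⇔Outside X v = mk⇔
  (λ h i → not-injective (trans (sym (Vecₚ.lookup-map (lookup v i) not X)) (h i)))
  (λ h i → trans (Vecₚ.lookup-map (lookup v i) not X) (cong not (h i)))

≤-foldr-⊔ : ∀ {A : Set} (f : A → ℕ) {x xs} → x ∈ xs → f x ≤ List.foldr (λ y acc → f y ⊔ acc) 0 xs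
≤-foldr-⊔ f (here refl)  = ℕₚ.m≤m⊔n _ _
≤-foldr-⊔ f {xs = y ∷ _} (there x∈xs) = ℕₚ.≤-trans (≤-foldr-⊔ f x∈xs) (ℕₚ.m≤n⊔m (f y) _)

ar≤maxArity : (τ : Vocabulary) (R : Fin (k τ)) → ar τ R ≤ maxArity τ
ar≤maxArity τ R = ≤-foldr-⊔ (ar τ) (∈ₚ.∈-allFin R)

≗⇒≡ : ∀ {A : Set} {l} {u v : Vec A l} → (∀ i → lookup u i ≡ lookup v i) → u ≡ v
≗⇒≡ {u = u} {v} h =
  trans (sym (Vecₚ.tabulate∘lookup u)) (trans (Vecₚ.tabulate-cong h) (Vecₚ.tabulate∘lookup v))

map-lookup-≡ : ∀ {A : Set} {L L′ l} (u : Vec A L) (v : Vec A L′) {σ : Vec (Fin L) l} {ρ : Vec (Fin L′) l} →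
               (∀ q → lookup u (lookup σ q) ≡ lookup v (lookup ρ q)) →
               Vec.map (lookup u) σ ≡ Vec.map (lookup v) ρ
map-lookup-≡ u v {σ} {ρ} h =
  ≗⇒≡ λ q → trans (Vecₚ.lookup-map q (lookup u) σ) (trans (h q) (sym (Vecₚ.lookup-map q (lookup v) ρ)))

↑-cases : ∀ m {n} (p : Fin (m + n)) → (∃ λ i → p ≡ i ↑ˡ n) ⊎ (∃ λ j → p ≡ m ↑ʳ j)
↑-cases m p with splitAt m p in eq
... | inj₁ i = inj₁ (i , sym (Finₚ.splitAt⁻¹-↑ˡ eq))
... | inj₂ j = inj₂ (j , sym (Finₚ.splitAt⁻¹-↑ʳ eq))

overwritePrefix : ∀ {A : Set} {a m} → Vec A a → Vec A m → a ≤ m → Vec A m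
overwritePrefix []       v       _         = v
overwritePrefix (c ∷ cs) (_ ∷ v) (s≤s a≤m) = c ∷ overwritePrefix cs v a≤m

lookup-overwritePrefix : ∀ {A : Set} {a m} (cs : Vec A a) (v : Vec A m) (a≤m : a ≤ m) q →
                         lookup (overwritePrefix cs v a≤m) (inject≤ q a≤m) ≡ lookup cs q
lookup-overwritePrefix (c ∷ cs) (_ ∷ v) (s≤s a≤m) Fin.zero    = refl
lookup-overwritePrefix (c ∷ cs) (_ ∷ v) (s≤s a≤m) (Fin.suc q) = lookup-overwritePrefix cs v a≤m q

overwritePrefix-pointwise : ∀ {A : Set} (P : A → Set) {a m} (cs : Vec A a) (v : Vec A m) (a≤m : a ≤ m) →
                            (∀ q → P (lookup cs q)) → (∀ r → P (lookup v r)) →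
                            ∀ r → P (lookup (overwritePrefix cs v a≤m) r)
overwritePrefix-pointwise P []       v       _         _  Pv r           = Pv r
overwritePrefix-pointwise P (c ∷ cs) (_ ∷ v) (s≤s a≤m) Pc Pv Fin.zero    = Pc Fin.zero
overwritePrefix-pointwise P (c ∷ cs) (_ ∷ v) (s≤s a≤m) Pc Pv (Fin.suc r) =
  overwritePrefix-pointwise P cs v a≤m (Pc ∘ Fin.suc) (Pv ∘ Fin.suc) r

does-≟-false : ∀ {n} (W : Subset n) {a b v} → lookup W a ≡ v → lookup W b ≡ not v → does (a ≟ b) ≡ false
does-≟-false W {a} {b} W[a]≡v W[b]≡¬v with a ≟ b
... | yes refl = ⊥-elim (not-¬ W[a]≡v W[b]≡¬v)
... | no _     = refl

nonempty? : ∀ {n} (W : Subset n) → Dec (∃ λ a → lookup W a ≡ true)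
nonempty? W = Finₚ.any? λ a → lookup W a ≟ᴮ true

deduplicate-distinct : ∀ {A : Set} {R : Rel A 0ℓ} (R? : Decidable R) xs →
                       AllPairs (λ a b → ¬ R a b) (deduplicate R? xs)
deduplicate-distinct R? []       = []
deduplicate-distinct R? (x ∷ xs) =
  All.tabulate (λ b∈ → proj₂ (∈ₚ.∈-filter⁻ (¬? ∘ R? x) {xs = deduplicate R? xs} b∈))
  ∷ AllPairsₚ.filter⁺ (¬? ∘ R? x) (deduplicate-distinct R? xs)

∈-─⁺ : ∀ {A : Set} {a b : A} {xs} (a∈xs : a ∈ xs) → b ∈ xs → b ≢ a → b ∈ xs ─ a∈xs
∈-─⁺ (here refl)  (here refl)  b≢a = ⊥-elim (b≢a refl)
∈-─⁺ (here refl)  (there b∈xs) _   = b∈xs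
∈-─⁺ (there a∈xs) (here refl)  _   = here refl
∈-─⁺ (there a∈xs) (there b∈xs) b≢a = there (∈-─⁺ a∈xs b∈xs b≢a)

length≤-by-injection : ∀ {A K : Set} (f : A → K) {xs ys} →
                       AllPairs (λ a b → f a ≢ f b) xs → All (λ a → f a ∈ ys) xs → length xs ≤ length ys
length≤-by-injection f                         []                 []               = z≤n
length≤-by-injection f {xs = a ∷ xs} {ys = ys} (fa≢ ∷ distinct) (fa∈ys ∷ images) = begin
  suc (length xs)           ≤⟨ s≤s (length≤-by-injection f distinct (All.zipWith shift (fa≢ , images))) ⟩
  suc (length (ys ─ fa∈ys)) ≡⟨ Listₚ.length-removeAt′ ys _ ⟨
  length ys                 ∎
  where
    open ℕₚ.≤-Reasoning
    shift : ∀ {b} → f a ≢ f b × f b ∈ ys → f b ∈ ys ─ fa∈ys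
    shift (fa≢fb , fb∈ys) = ∈-─⁺ fa∈ys fb∈ys (fa≢fb ∘ sym)

AllPairs-mapWithAll : ∀ {A : Set} {P : A → Set} {R S : Rel A 0ℓ} →
                      (∀ {a b} → P a → P b → R a b → S a b) → ∀ {xs} → All P xs → AllPairs R xs → AllPairs S xs
AllPairs-mapWithAll f []         []         = []
AllPairs-mapWithAll f (pa ∷ pas) (ra ∷ ras) =
  All.zipWith (λ (pb , rab) → f pa pb rab) (pas , ra) ∷ AllPairs-mapWithAll f pas ras

allBoolVecs : ∀ l → List (Vec Bool l)
allBoolVecs zero    = [] ∷ []
allBoolVecs (suc l) = List.map (true ∷_) (allBoolVecs l) List.++ List.map (false ∷_) (allBoolVecs l)

length-allBoolVecs : ∀ l → length (allBoolVecs l) ≡ 2 ^ l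
length-allBoolVecs zero    = refl
length-allBoolVecs (suc l) = begin
  length (List.map (true ∷_) bs List.++ List.map (false ∷_) bs)
    ≡⟨ Listₚ.length-++ (List.map (true ∷_) bs) ⟩
  length (List.map (true ∷_) bs) + length (List.map (false ∷_) bs)
    ≡⟨ cong₂ _+_ (Listₚ.length-map (true ∷_) bs) (Listₚ.length-map (false ∷_) bs) ⟩
  length bs + length bs
    ≡⟨ cong₂ _+_ (length-allBoolVecs l) (trans (length-allBoolVecs l) (sym (ℕₚ.+-identityʳ _))) ⟩
  2 ^ suc l ∎
  where
    open ≡-Reasoning
    bs : List (Vec Bool l)
    bs = allBoolVecs l

∈-allBoolVecs : ∀ {l} (v : Vec Bool l) → v ∈ allBoolVecs l
∈-allBoolVecs []          = here refl
∈-allBoolVecs (true ∷ v)  = ∈ₚ.∈-++⁺ˡ (∈ₚ.∈-map⁺ (true ∷_) (∈-allBoolVecs v))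
∈-allBoolVecs (false ∷ v) = ∈ₚ.∈-++⁺ʳ _ (∈ₚ.∈-map⁺ (false ∷_) (∈-allBoolVecs v))

length-cartesianProduct : ∀ {A B : Set} (xs : List A) (ys : List B) →
                          length (cartesianProduct xs ys) ≡ length xs * length ys
length-cartesianProduct []       ys = refl
length-cartesianProduct (x ∷ xs) ys = begin
  length (List.map (x ,_) ys List.++ cartesianProduct xs ys)
    ≡⟨ Listₚ.length-++ (List.map (x ,_) ys) ⟩
  length (List.map (x ,_) ys) + length (cartesianProduct xs ys)
    ≡⟨ cong₂ _+_ (Listₚ.length-map (x ,_) ys) (length-cartesianProduct xs ys) ⟩
  length ys + length xs * length ys ∎
  where open ≡-Reasoning

_⊆ᵇ_ : ∀ {n} → Subset n → Subset n → Set
W ⊆ᵇ U = ∀ a → lookup W a ≡ true → lookup U a ≡ true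

data AgreeOutside {n} (W : Subset n) (a a' : Fin n) : Set where
  inside  : lookup W a ≡ true → lookup W a' ≡ true → AgreeOutside W a a'
  outside : a ≡ a' → lookup W a ≡ false → AgreeOutside W a a'

AgreeInside : ∀ {n l} → Subset n → Vec (Fin n) l → Vec (Fin n) l → Set
AgreeInside W x w = ∀ i → lookup W (lookup x i) ≡ true → lookup w i ≡ lookup x i

Tuple : {τ : Vocabulary} → Structure τ → Set
Tuple {τ} 𝔄 = Vec (Fin (size 𝔄)) (maxArity τ)

module _ {τ : Vocabulary} (𝔄 : Structure τ) where

  record QfEquiv {l} (z z' : Vec (Fin (size 𝔄)) l) : Set where
    field
      eq-atoms  : ∀ i j → does (lookup z i ≟ lookup z j) ≡ does (lookup z' i ≟ lookup z' j)
      rel-atoms : ∀ R (σ : Vec (Fin l) (ar τ R)) →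
                  rel 𝔄 R (Vec.map (lookup z) σ) ≡ rel 𝔄 R (Vec.map (lookup z') σ)
  open QfEquiv public

  sameQfType⇒QfEquiv : ∀ {l} (z z' : Vec (Fin (size 𝔄)) l) → T (sameQfType 𝔄 z z') → QfEquiv z z'
  sameQfType⇒QfEquiv z z' t with Equivalence.to T-∧ t
  ... | eqs , rels = record
    { eq-atoms  = λ i j → ==⇒≡ _ _ (all-sound _ (all-sound _ eqs (∈ₚ.∈-allFin i)) (∈ₚ.∈-allFin j))
    ; rel-atoms = λ R σ → ==⇒≡ _ _ (all-sound _ (all-sound _ rels (∈ₚ.∈-allFin R)) (∈-allTuples σ))
    }

  QfEquiv⇒sameQfType : ∀ {l} (z z' : Vec (Fin (size 𝔄)) l) → QfEquiv z z' → T (sameQfType 𝔄 z z')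
  QfEquiv⇒sameQfType {l} z z' e = Equivalence.from T-∧
    ( all-complete _ (allFin l) (λ {i} _ → all-complete _ (allFin l) (λ {j} _ → ≡⇒== (eq-atoms e i j)))
    , all-complete _ (allFin (k τ)) (λ {R} _ →
        all-complete _ (allTuples l (ar τ R)) (λ {σ} _ → ≡⇒== (rel-atoms e R σ)))
    )

  QfEquiv-refl : ∀ {l} {z : Vec (Fin (size 𝔄)) l} → QfEquiv z z
  QfEquiv-refl = record { eq-atoms = λ _ _ → refl ; rel-atoms = λ _ _ → refl }

  QfEquiv-sym : ∀ {l} {z z' : Vec (Fin (size 𝔄)) l} → QfEquiv z z' → QfEquiv z' z
  QfEquiv-sym e = record
    { eq-atoms = λ i j → sym (eq-atoms e i j) ; rel-atoms = λ R σ → sym (rel-atoms e R σ) }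

  QfEquiv-trans : ∀ {l} {z z' z'' : Vec (Fin (size 𝔄)) l} → QfEquiv z z' → QfEquiv z' z'' → QfEquiv z z''
  QfEquiv-trans e f = record
    { eq-atoms  = λ i j → trans (eq-atoms e i j) (eq-atoms f i j)
    ; rel-atoms = λ R σ → trans (rel-atoms e R σ) (rel-atoms f R σ)
    }

  SameRow : Subset (size 𝔄) → Tuple 𝔄 → Tuple 𝔄 → Set
  SameRow X x x' = ∀ (y : Tuple 𝔄) → Outside X y → QfEquiv (x ++ y) (x' ++ y)

  sameRow⇒SameRow : ∀ X x x' → T (sameRow 𝔄 X x x') → SameRow X x x'
  sameRow⇒SameRow X x x' t y y∉X = sameQfType⇒QfEquiv (x ++ y) (x' ++ y)
    (all-sound _ t (∈-tuplesIn⁺ (Equivalence.from (Inside-∁⇔Outside X y) y∉X)))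

  SameRow⇒sameRow : ∀ X x x' → SameRow X x x' → T (sameRow 𝔄 X x x')
  SameRow⇒sameRow X x x' r = all-complete _ (tuplesIn (maxArity τ) (∁ X)) λ {y} y∈ →
    QfEquiv⇒sameQfType (x ++ y) (x' ++ y) (r y (Equivalence.to (Inside-∁⇔Outside X y) (∈-tuplesIn⁻ y∈)))

  SameRow-refl : ∀ X {x} → SameRow X x x
  SameRow-refl X y _ = QfEquiv-refl

  SameRow-sym : ∀ X {x x'} → SameRow X x x' → SameRow X x' x
  SameRow-sym X r y y∉X = QfEquiv-sym (r y y∉X)

  SameRow-trans : ∀ X {x x' x''} → SameRow X x x' → SameRow X x' x'' → SameRow X x x''
  SameRow-trans X r s y y∉X = QfEquiv-trans (r y y∉X) (s y y∉X)

  private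
    module Transfer {W U : Subset (size 𝔄)} (W⊆U : W ⊆ᵇ U)
                    {x x' w w' : Tuple 𝔄} (agree : ∀ i → AgreeOutside W (lookup x i) (lookup x' i))
                    (w≈x : AgreeInside W x w) (w'≈x' : AgreeInside W x' w') (w~w' : SameRow W w w')
                    (y : Tuple 𝔄) (y∉U : Outside U y) where

      m : ℕ
      m = maxArity τ

      y∉W : Outside W y
      y∉W j with lookup W (lookup y j) in e
      ... | false = refl
      ... | true  = trans (sym (W⊆U _ e)) (y∉U j)

      z z' : Vec (Fin (size 𝔄)) (m + m)
      z  = x ++ y
      z' = x' ++ y

      data Position : Fin (m + m) → Set where
        inW   : ∀ i → lookup W (lookup x i) ≡ true → lookup W (lookup x' i) ≡ true → Position (i ↑ˡ m)
        fixed : ∀ {p} → lookup z p ≡ lookup z' p → lookup W (lookup z p) ≡ false → Position p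

      position : ∀ p → Position p
      position p with ↑-cases m p
      ... | inj₂ (j , refl) =
        fixed (trans (Vecₚ.lookup-++ʳ x y j) (sym (Vecₚ.lookup-++ʳ x' y j)))
              (trans (cong (lookup W) (Vecₚ.lookup-++ʳ x y j)) (y∉W j))
      ... | inj₁ (i , refl) with agree i
      ...   | inside  x∈W x'∈W = inW i x∈W x'∈W
      ...   | outside x≡x' x∉W =
        fixed (trans (Vecₚ.lookup-++ˡ x y i) (trans x≡x' (sym (Vecₚ.lookup-++ˡ x' y i))))
              (trans (cong (lookup W) (Vecₚ.lookup-++ˡ x y i)) x∉W)

      fixed-z' : ∀ {p} → lookup z p ≡ lookup z' p → lookup W (lookup z p) ≡ false →
                 lookup W (lookup z' p) ≡ false
      fixed-z' z≡z' z∉W = trans (cong (lookup W) (sym z≡z')) z∉W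

      inW-left : ∀ (c : Tuple 𝔄) i → lookup W (lookup x i) ≡ true →
                 lookup (w ++ c) (i ↑ˡ m) ≡ lookup z (i ↑ˡ m)
      inW-left c i x∈W = trans (Vecₚ.lookup-++ˡ w c i) (trans (w≈x i x∈W) (sym (Vecₚ.lookup-++ˡ x y i)))

      inW-right : ∀ (c : Tuple 𝔄) i → lookup W (lookup x' i) ≡ true →
                  lookup (w' ++ c) (i ↑ˡ m) ≡ lookup z' (i ↑ˡ m)
      inW-right c i x'∈W =
        trans (Vecₚ.lookup-++ˡ w' c i) (trans (w'≈x' i x'∈W) (sym (Vecₚ.lookup-++ˡ x' y i)))

      z-inW : ∀ i → lookup W (lookup x i) ≡ true → lookup W (lookup z (i ↑ˡ m)) ≡ true
      z-inW i x∈W = trans (cong (lookup W) (Vecₚ.lookup-++ˡ x y i)) x∈W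

      z'-inW : ∀ i → lookup W (lookup x' i) ≡ true → lookup W (lookup z' (i ↑ˡ m)) ≡ true
      z'-inW i x'∈W = trans (cong (lookup W) (Vecₚ.lookup-++ˡ x' y i)) x'∈W

      _≟ᵇ_ : Fin (size 𝔄) → Fin (size 𝔄) → Bool
      a ≟ᵇ b = does (a ≟ b)

      eq-atom : ∀ p₁ p₂ → lookup z p₁ ≟ᵇ lookup z p₂ ≡ lookup z' p₁ ≟ᵇ lookup z' p₂
      eq-atom p₁ p₂ with position p₁ | position p₂
      ... | inW i₁ x∈W₁ x'∈W₁ | inW i₂ x∈W₂ x'∈W₂ = begin
        lookup z (i₁ ↑ˡ m) ≟ᵇ lookup z (i₂ ↑ˡ m)
          ≡⟨ sym (cong₂ _≟ᵇ_ (inW-left y i₁ x∈W₁) (inW-left y i₂ x∈W₂)) ⟩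
        lookup (w ++ y) (i₁ ↑ˡ m) ≟ᵇ lookup (w ++ y) (i₂ ↑ˡ m)
          ≡⟨ eq-atoms (w~w' y y∉W) (i₁ ↑ˡ m) (i₂ ↑ˡ m) ⟩
        lookup (w' ++ y) (i₁ ↑ˡ m) ≟ᵇ lookup (w' ++ y) (i₂ ↑ˡ m)
          ≡⟨ cong₂ _≟ᵇ_ (inW-right y i₁ x'∈W₁) (inW-right y i₂ x'∈W₂) ⟩
        lookup z' (i₁ ↑ˡ m) ≟ᵇ lookup z' (i₂ ↑ˡ m) ∎
        where open ≡-Reasoning
      ... | inW i₁ x∈W x'∈W | fixed z≡z' z∉W =
        trans (does-≟-false W (z-inW i₁ x∈W) z∉W)
              (sym (does-≟-false W (z'-inW i₁ x'∈W) (fixed-z' z≡z' z∉W)))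
      ... | fixed z≡z' z∉W | inW i₂ x∈W x'∈W =
        trans (does-≟-false W z∉W (z-inW i₂ x∈W))
              (sym (does-≟-false W (fixed-z' z≡z' z∉W) (z'-inW i₂ x'∈W)))
      ... | fixed z≡z'₁ _ | fixed z≡z'₂ _ = cong₂ _≟ᵇ_ z≡z'₁ z≡z'₂

      -- The arguments of R that are not W-entries of x̄ are copied into a column of the type matrix of W;
      -- the other entries of that column are taken from ȳ and never read.
      module RelationAtom (R : Fin (k τ)) (σ : Vec (Fin (m + m)) (ar τ R)) where

        a≤m : ar τ R ≤ m
        a≤m = ar≤maxArity τ R

        fill : ∀ {p} → Position p → Fin (ar τ R) → Fin (size 𝔄)
        fill (inW _ _ _)         q = lookup y (inject≤ q a≤m)
        fill (fixed {p} _ _)     _ = lookup z p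

        target : ∀ {p} → Position p → Fin (ar τ R) → Fin (m + m)
        target (inW i _ _) _ = i ↑ˡ m
        target (fixed _ _) q = m ↑ʳ inject≤ q a≤m

        fill∉W : ∀ {p} (c : Position p) q → lookup W (fill c q) ≡ false
        fill∉W (inW _ _ _)   q = y∉W (inject≤ q a≤m)
        fill∉W (fixed _ z∉W) _ = z∉W

        fills : Vec (Fin (size 𝔄)) (ar τ R)
        fills = tabulate λ q → fill (position (lookup σ q)) q

        column : Tuple 𝔄
        column = overwritePrefix fills y a≤m

        column∉W : Outside W column
        column∉W = overwritePrefix-pointwise (λ b → lookup W b ≡ false) fills y a≤m
          (λ q → trans (cong (lookup W) (Vecₚ.lookup∘tabulate _ q)) (fill∉W (position (lookup σ q)) q))
          y∉W

        σ′ : Vec (Fin (m + m)) (ar τ R)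
        σ′ = tabulate λ q → target (position (lookup σ q)) q

        column-at : ∀ q → lookup column (inject≤ q a≤m) ≡ fill (position (lookup σ q)) q
        column-at q = trans (lookup-overwritePrefix fills y a≤m q) (Vecₚ.lookup∘tabulate _ q)

        left-at : ∀ {p} (c : Position p) q → lookup column (inject≤ q a≤m) ≡ fill c q →
                  lookup (w ++ column) (target c q) ≡ lookup z p
        left-at (inW i x∈W _)  q _          = inW-left column i x∈W
        left-at (fixed _ _)    q column≡z   = trans (Vecₚ.lookup-++ʳ w column _) column≡z

        right-at : ∀ {p} (c : Position p) q → lookup column (inject≤ q a≤m) ≡ fill c q →
                   lookup (w' ++ column) (target c q) ≡ lookup z' p
        right-at (inW i _ x'∈W)   q _        = inW-right column i x'∈W
        right-at (fixed z≡z' _)   q column≡z = trans (Vecₚ.lookup-++ʳ w' column _) (trans column≡z z≡z')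

        left : ∀ q → lookup (w ++ column) (lookup σ′ q) ≡ lookup z (lookup σ q)
        left q = trans (cong (lookup (w ++ column)) (Vecₚ.lookup∘tabulate _ q))
                       (left-at (position (lookup σ q)) q (column-at q))

        right : ∀ q → lookup (w' ++ column) (lookup σ′ q) ≡ lookup z' (lookup σ q)
        right q = trans (cong (lookup (w' ++ column)) (Vecₚ.lookup∘tabulate _ q))
                        (right-at (position (lookup σ q)) q (column-at q))

        rel-atom : rel 𝔄 R (Vec.map (lookup z) σ) ≡ rel 𝔄 R (Vec.map (lookup z') σ)
        rel-atom = begin
          rel 𝔄 R (Vec.map (lookup z) σ)
            ≡⟨ cong (rel 𝔄 R) (map-lookup-≡ (w ++ column) z left) ⟨
          rel 𝔄 R (Vec.map (lookup (w ++ column)) σ′)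
            ≡⟨ rel-atoms (w~w' column column∉W) R σ′ ⟩
          rel 𝔄 R (Vec.map (lookup (w' ++ column)) σ′)
            ≡⟨ cong (rel 𝔄 R) (map-lookup-≡ (w' ++ column) z' right) ⟩
          rel 𝔄 R (Vec.map (lookup z') σ) ∎
          where open ≡-Reasoning

      qfEquiv : QfEquiv z z'
      qfEquiv = record { eq-atoms = eq-atom ; rel-atoms = RelationAtom.rel-atom }

  SameRow-transfer : ∀ (W U : Subset (size 𝔄)) → W ⊆ᵇ U →
                     ∀ {x x' w w' : Tuple 𝔄} → (∀ i → AgreeOutside W (lookup x i) (lookup x' i)) →
                     AgreeInside W x w → AgreeInside W x' w' → SameRow W w w' → SameRow U x x'
  SameRow-transfer W U W⊆U agree w≈x w'≈x' w~w' y y∉U =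
    Transfer.qfEquiv {W} {U} W⊆U agree w≈x w'≈x' w~w' y y∉U

  rowRepresentatives : Subset (size 𝔄) → List (Tuple 𝔄)
  rowRepresentatives X = List.deduplicateᵇ (sameRow 𝔄 X) (tuplesIn (maxArity τ) X)

  rowRepresentatives-inside : ∀ {X d} → d ∈ rowRepresentatives X → Inside X d
  rowRepresentatives-inside {X} d∈ = ∈-tuplesIn⁻ (Anyₚ.deduplicate⁻ (λ a b → T? (sameRow 𝔄 X a b)) d∈)

  rowRepresentatives-cover : ∀ {X v} → Inside X v → ∃ λ d → d ∈ rowRepresentatives X × SameRow X v d
  rowRepresentatives-cover {X} {v} v∈X = find (Anyₚ.deduplicate⁺ (λ a b → T? (sameRow 𝔄 X a b)) respects
    (lose (∈-tuplesIn⁺ v∈X) (SameRow-refl X)))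
    where
      respects : ∀ {a b} → T (sameRow 𝔄 X b a) → SameRow X v a → SameRow X v b
      respects {a} {b} b~a v~a = SameRow-trans X v~a (SameRow-sym X (sameRow⇒SameRow X b a b~a))

  rowRepresentatives-distinct : ∀ X → AllPairs (λ a b → ¬ SameRow X a b) (rowRepresentatives X)
  rowRepresentatives-distinct X = AllPairs.map (λ {a} {b} ¬a~b → ¬a~b ∘ SameRow⇒sameRow X a b)
    (deduplicate-distinct (λ a b → T? (sameRow 𝔄 X a b)) (tuplesIn (maxArity τ) X))

  pad : Subset (size 𝔄) → Fin (size 𝔄) → Tuple 𝔄 → Tuple 𝔄
  pad W a₀ = Vec.map λ b → if lookup W b then b else a₀

  lookup-pad : ∀ W a₀ x i → lookup (pad W a₀ x) i ≡ (if lookup W (lookup x i) then lookup x i else a₀)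
  lookup-pad W a₀ x i = Vecₚ.lookup-map i _ x

  pad-inside : ∀ W a₀ x → lookup W a₀ ≡ true → Inside W (pad W a₀ x)
  pad-inside W a₀ x a₀∈W i rewrite lookup-pad W a₀ x i with lookup W (lookup x i) in x∈W
  ... | true  = x∈W
  ... | false = a₀∈W

  pad-agree : ∀ W a₀ x → AgreeInside W x (pad W a₀ x)
  pad-agree W a₀ x i x∈W rewrite lookup-pad W a₀ x i | x∈W = refl

  -- Padding the entries outside W requires an element of W; when W is empty there is nothing to replace.
  representativeFrom : (W : Subset (size 𝔄)) → Dec (∃ λ a → lookup W a ≡ true) → Tuple 𝔄 → Maybe (Tuple 𝔄)
  representativeFrom W (yes (a₀ , a₀∈W)) x =
    just (proj₁ (rowRepresentatives-cover {W} {pad W a₀ x} (pad-inside W a₀ x a₀∈W)))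
  representativeFrom W (no _)            x = nothing

  representative : Subset (size 𝔄) → Tuple 𝔄 → Maybe (Tuple 𝔄)
  representative W = representativeFrom W (nonempty? W)

  representative-sound : ∀ {W x d} → representative W x ≡ just d →
                         d ∈ rowRepresentatives W × ∃ λ w → AgreeInside W x w × SameRow W w d
  representative-sound {W} {x} = sound (nonempty? W)
    where
      sound : ∀ {d} dec → representativeFrom W dec x ≡ just d →
              d ∈ rowRepresentatives W × ∃ λ w → AgreeInside W x w × SameRow W w d
      sound (yes (a₀ , a₀∈W)) refl =
        let _ , d∈ , w~d = rowRepresentatives-cover {W} {pad W a₀ x} (pad-inside W a₀ x a₀∈W)
        in  d∈ , pad W a₀ x , pad-agree W a₀ x , w~d

  representative-exists : ∀ {W} x i → lookup W (lookup x i) ≡ true → ∃ λ d → representative W x ≡ just d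
  representative-exists {W} x i x∈W with nonempty? W
  ... | yes _ = _ , refl
  ... | no ∄  = ⊥-elim (∄ (lookup x i , x∈W))

  replaceAt : Subset (size 𝔄) → Maybe (Tuple 𝔄) → Fin (size 𝔄) → Fin (maxArity τ) → Fin (size 𝔄)
  replaceAt W nothing  a _ = a
  replaceAt W (just d) a i = if lookup W a then lookup d i else a

  replace : Subset (size 𝔄) → Maybe (Tuple 𝔄) → Tuple 𝔄 → Tuple 𝔄
  replace W nothing  x = x
  replace W (just d) x = tabulate λ i → replaceAt W (just d) (lookup x i) i

  lookup-replace : ∀ W s x i → lookup (replace W s x) i ≡ replaceAt W s (lookup x i) i
  lookup-replace W nothing  x i = refl
  lookup-replace W (just d) x i = Vecₚ.lookup∘tabulate _ i

  lookup-replace-outside : ∀ W s x i → lookup W (lookup x i) ≡ false →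
                           lookup (replace W s x) i ≡ lookup x i
  lookup-replace-outside W nothing  x i _   = refl
  lookup-replace-outside W (just d) x i x∉W rewrite lookup-replace W (just d) x i | x∉W = refl

  lookup-replace-inside : ∀ W d x i → lookup W (lookup x i) ≡ true →
                          lookup (replace W (just d) x) i ≡ lookup d i
  lookup-replace-inside W d x i x∈W rewrite lookup-replace W (just d) x i | x∈W = refl

  SameRow-replace : ∀ W U → W ⊆ᵇ U → ∀ {x w d} →
                    Inside W d → AgreeInside W x w → SameRow W w d → SameRow U x (replace W (just d) x)
  SameRow-replace W U W⊆U {x} {w} {d} d∈W w≈x w~d = SameRow-transfer W U W⊆U agree w≈x d≈x′ w~d
    where
      x′ : Tuple 𝔄
      x′ = replace W (just d) x

      agree : ∀ i → AgreeOutside W (lookup x i) (lookup x′ i)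
      agree i with lookup W (lookup x i) in x∈W
      ... | true  = inside x∈W (trans (cong (lookup W) (lookup-replace-inside W d x i x∈W)) (d∈W i))
      ... | false = outside (sym (lookup-replace-outside W (just d) x i x∈W)) x∈W

      d≈x′ : AgreeInside W x′ d
      d≈x′ i x′∈W with lookup W (lookup x i) in x∈W
      ... | true  = sym (lookup-replace-inside W d x i x∈W)
      ... | false =
        ⊥-elim (not-¬ x′∈W (trans (cong (lookup W) (lookup-replace-outside W (just d) x i x∈W)) x∈W))

  canonicalize : Subset (size 𝔄) → Tuple 𝔄 → Tuple 𝔄
  canonicalize W x = replace W (representative W x) x

  SameRow-canonicalize : ∀ W U → W ⊆ᵇ U → ∀ x → SameRow U x (canonicalize W x)
  SameRow-canonicalize W U W⊆U x with representative W x in rep≡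
  ... | nothing = SameRow-refl U
  ... | just d  =
    let d∈ , w , w≈x , w~d = representative-sound {W} rep≡
    in  SameRow-replace W U W⊆U (rowRepresentatives-inside d∈) w≈x w~d

  options : Subset (size 𝔄) → List (Maybe (Tuple 𝔄))
  options W = nothing ∷ List.map just (rowRepresentatives W)

  representative∈options : ∀ W x → representative W x ∈ options W
  representative∈options W x with representative W x in rep≡
  ... | nothing = here refl
  ... | just d  = there (∈ₚ.∈-map⁺ just (proj₁ (representative-sound {W} rep≡)))

  length-options : ∀ W → length (options W) ≡ suc (cutRank 𝔄 W)
  length-options W = cong suc (Listₚ.length-map just (rowRepresentatives W))

  module _ (X Y : Subset (size 𝔄)) where

    private
      U : Subset (size 𝔄)
      U = X ∪ Y

      lookup-∪ : ∀ a → lookup U a ≡ lookup X a ∨ lookup Y a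
      lookup-∪ a = Vecₚ.lookup-zipWith _∨_ a X Y

      X⊆U : X ⊆ᵇ U
      X⊆U a a∈X = trans (lookup-∪ a) (cong (_∨ lookup Y a) a∈X)

      Y⊆U : Y ⊆ᵇ U
      Y⊆U a a∈Y = trans (lookup-∪ a) (trans (cong (lookup X a ∨_) a∈Y) (∨-zeroʳ (lookup X a)))

      U∖X⊆Y : ∀ a → lookup U a ≡ true → lookup X a ≡ false → lookup Y a ≡ true
      U∖X⊆Y a a∈U a∉X = trans (cong (_∨ lookup Y a) (sym a∉X)) (trans (sym (lookup-∪ a)) a∈U)

      repX repY : Tuple 𝔄 → Maybe (Tuple 𝔄)
      repX x = representative X x
      repY x = representative Y (canonicalize X x)

      canonical : Tuple 𝔄 → Tuple 𝔄
      canonical x = canonicalize Y (canonicalize X x)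

      SameRow-canonical : ∀ x → SameRow U x (canonical x)
      SameRow-canonical x =
        SameRow-trans U (SameRow-canonicalize X U X⊆U x)
                        (SameRow-canonicalize Y U Y⊆U (canonicalize X x))

      Key : Set
      Key = Vec Bool (maxArity τ) × Maybe (Tuple 𝔄) × Maybe (Tuple 𝔄)

      key : Tuple 𝔄 → Key
      key x = Vec.map (lookup X) x , repX x , repY x

      canonical-inside-X : ∀ x i {d} → repX x ≡ just d → lookup X (lookup x i) ≡ true →
                           lookup (canonical x) i ≡ replaceAt Y (repY x) (lookup d i) i
      canonical-inside-X x i {d} rep≡d x∈X = begin
        lookup (canonical x) i
          ≡⟨ lookup-replace Y (repY x) (canonicalize X x) i ⟩
        replaceAt Y (repY x) (lookup (canonicalize X x) i) i
          ≡⟨ cong (λ a → replaceAt Y (repY x) a i) x₁-at ⟩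
        replaceAt Y (repY x) (lookup d i) i ∎
        where
          open ≡-Reasoning
          x₁-at : lookup (canonicalize X x) i ≡ lookup d i
          x₁-at rewrite rep≡d = lookup-replace-inside X d x i x∈X

      canonical-outside-X : ∀ x i {e} → lookup X (lookup x i) ≡ false → lookup Y (lookup x i) ≡ true →
                            repY x ≡ just e → lookup (canonical x) i ≡ lookup e i
      canonical-outside-X x i {e} x∉X x∈Y rep≡e rewrite rep≡e =
        lookup-replace-inside Y e (canonicalize X x) i
          (trans (cong (lookup Y) (lookup-replace-outside X (repX x) x i x∉X)) x∈Y)

      canonical-determined : ∀ {x x'} → Inside U x → Inside U x' → key x ≡ key x' →
                             canonical x ≡ canonical x'
      canonical-determined {x} {x'} x∈U x'∈U key≡ = ≗⇒≡ at
        where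
          X-pattern≡ : ∀ i → lookup X (lookup x i) ≡ lookup X (lookup x' i)
          X-pattern≡ i = trans (sym (Vecₚ.lookup-map i (lookup X) x))
            (trans (cong (λ p → lookup p i) (cong proj₁ key≡)) (Vecₚ.lookup-map i (lookup X) x'))

          repX≡ : repX x ≡ repX x'
          repX≡ = cong (proj₁ ∘ proj₂) key≡

          repY≡ : repY x ≡ repY x'
          repY≡ = cong (proj₂ ∘ proj₂) key≡

          at : ∀ i → lookup (canonical x) i ≡ lookup (canonical x') i
          at i with lookup X (lookup x i) in x∈X
          ... | true =
            let d , rep≡d = representative-exists x i x∈X
                x'∈X = trans (sym (X-pattern≡ i)) x∈X
            in  begin
              lookup (canonical x) i               ≡⟨ canonical-inside-X x i rep≡d x∈X ⟩
              replaceAt Y (repY x) (lookup d i) i  ≡⟨ cong (λ s → replaceAt Y s (lookup d i) i) repY≡ ⟩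
              replaceAt Y (repY x') (lookup d i) i ≡⟨ canonical-inside-X x' i (trans (sym repX≡) rep≡d) x'∈X ⟨
              lookup (canonical x') i              ∎
            where open ≡-Reasoning
          ... | false =
            let x'∉X = trans (sym (X-pattern≡ i)) x∈X
                x∈Y  = U∖X⊆Y _ (x∈U i) x∈X
                e , rep≡e = representative-exists (canonicalize X x) i
                  (trans (cong (lookup Y) (lookup-replace-outside X (repX x) x i x∈X)) x∈Y)
                x'∈Y = U∖X⊆Y _ (x'∈U i) x'∉X
            in  trans (canonical-outside-X x i x∈X x∈Y rep≡e)
                      (sym (canonical-outside-X x' i x'∉X x'∈Y (trans (sym repY≡) rep≡e)))

      key-injective : ∀ {x x'} → Inside U x → Inside U x' → key x ≡ key x' → SameRow U x x'
      key-injective {x} {x'} x∈U x'∈U key≡ =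
        SameRow-trans U (SameRow-canonical x)
          (subst (λ c → SameRow U c x') (sym (canonical-determined x∈U x'∈U key≡))
            (SameRow-sym U (SameRow-canonical x')))

      keys : List Key
      keys = cartesianProduct (allBoolVecs (maxArity τ)) (cartesianProduct (options X) (options Y))

      key∈keys : ∀ x → key x ∈ keys
      key∈keys x = ∈ₚ.∈-cartesianProduct⁺ (∈-allBoolVecs _)
        (∈ₚ.∈-cartesianProduct⁺ (representative∈options X x)
                                (representative∈options Y (canonicalize X x)))

      length-keys : length keys ≡ 2 ^ maxArity τ * (suc (cutRank 𝔄 X) * suc (cutRank 𝔄 Y))
      length-keys = begin
        length keys
          ≡⟨ length-cartesianProduct (allBoolVecs m) (cartesianProduct (options X) (options Y)) ⟩
        length (allBoolVecs m) * length (cartesianProduct (options X) (options Y))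
          ≡⟨ cong₂ _*_ (length-allBoolVecs m) (length-cartesianProduct (options X) (options Y)) ⟩
        2 ^ m * (length (options X) * length (options Y))
          ≡⟨ cong (2 ^ m *_) (cong₂ _*_ (length-options X) (length-options Y)) ⟩
        2 ^ m * (suc (cutRank 𝔄 X) * suc (cutRank 𝔄 Y)) ∎
        where
          open ≡-Reasoning
          m : ℕ
          m = maxArity τ

    cutRank-∪-≤ : cutRank 𝔄 (X ∪ Y) ≤ 2 ^ maxArity τ * (suc (cutRank 𝔄 X) * suc (cutRank 𝔄 Y))
    cutRank-∪-≤ = begin
      length (rowRepresentatives U) ≤⟨ length≤-by-injection key distinct-keys (All.tabulate λ _ → key∈keys _) ⟩
      length keys                   ≡⟨ length-keys ⟩
      2 ^ maxArity τ * (suc (cutRank 𝔄 X) * suc (cutRank 𝔄 Y)) ∎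
      where
        open ℕₚ.≤-Reasoning
        distinct-keys : AllPairs (λ a b → key a ≢ key b) (rowRepresentatives U)
        distinct-keys = AllPairs-mapWithAll (λ a∈U b∈U a≁b → a≁b ∘ key-injective a∈U b∈U)
          (All.tabulate rowRepresentatives-inside) (rowRepresentatives-distinct U)

lemma3p10 : (τ : Vocabulary) (C : Structure τ → Set) → IsoClosed C →
            AsympBounded {Triple C} cutRankUnion cutRankMax
lemma3p10 τ C _ Z (b , max≤b) = 2 ^ maxArity τ * (suc b * suc b) , λ t t∈Z →
  let cX≤b = ℕₚ.≤-trans (ℕₚ.m≤m⊔n (cutRank (𝔄 t) (X t)) _) (max≤b t t∈Z)
      cY≤b = ℕₚ.≤-trans (ℕₚ.m≤n⊔m _ (cutRank (𝔄 t) (Y t))) (max≤b t t∈Z)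
  in  ℕₚ.≤-trans (cutRank-∪-≤ (𝔄 t) (X t) (Y t))
                 (ℕₚ.*-monoʳ-≤ (2 ^ maxArity τ) (ℕₚ.*-mono-≤ (s≤s cX≤b) (s≤s cY≤b)))
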